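{- Let $d$ be a squarefree natural number and $k=\mathbb{Q}(\sqrt d,i)$, where $i=\sqrt{ -1}$. Let $a+ib$ be an element of $\mathbb{Q}(i)$ such that $\sqrt{a^2+b^2}\notin\mathbb{Q}(\sqrt d)$, and let $\mathcal{H}$ be an ideal of $k$ such that $\mathcal{H}^2=(a+ib)$. Then the class of $\mathcal{H}$ has order $2$ in the class group of $k$. -}

module Defs where

open import Data.Nat as ℕ using (ℕ; _≤_)
open import Data.Nat.Divisibility using (_∣_)
open import Data.Nat.Primality using (Prime)
open import Data.Integer using (ℤ)
open import Data.Rational as ℚ using (ℚ; 0ℚ; 1ℚ)
open import Data.List using (List; []; _∷_; map; foldr)
open import Data.List.Relation.Unary.All using (All)
open import Data.Product using (Σ; _×_; _,_; ∃)
open import Relation.Binary.PropositionalEquality using (_≡_)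
open import Relation.Nullary using (¬_)

SquareFree : ℕ → Set
SquareFree d = ∀ p → Prime p → ¬ (p ℕ.* p ∣ d)

record QD (d : ℕ) : Set where
  constructor _+√_
  field
    re : ℚ
    sq : ℚ
open QD public

module _ {d : ℕ} where
  dℚ : ℚ
  dℚ = Data.Integer.+ d ℚ./ 1

  infixl 6 _+ᵈ_
  infixl 7 _*ᵈ_
  _+ᵈ_ : QD d → QD d → QD d
  (p +√ q) +ᵈ (r +√ s) = (p ℚ.+ r) +√ (q ℚ.+ s)

  _*ᵈ_ : QD d → QD d → QD d
  (p +√ q) *ᵈ (r +√ s) = (p ℚ.* r ℚ.+ dℚ ℚ.* (q ℚ.* s)) +√ (p ℚ.* s ℚ.+ q ℚ.* r)

  -ᵈ_ : QD d → QD d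
  -ᵈ (p +√ q) = (ℚ.- p) +√ (ℚ.- q)

  ofℚᵈ : ℚ → QD d
  ofℚᵈ p = p +√ 0ℚ

-- The field k = Q(√d, i) = Q(√d)(i): pairs (u , v) meaning u + v i,
-- with u v ∈ Q(√d) and i² = -1.  Equality is propositional equality
-- (ℚ is normalised and {1, √d, i, √d i} is a Q-basis for d ≥ 2 squarefree).

record K (d : ℕ) : Set where
  constructor _+i_
  field
    realPart : QD d
    imagPart : QD d
open K public

module _ {d : ℕ} where
  infixl 6 _+ₖ_
  infixl 7 _*ₖ_
  _+ₖ_ : K d → K d → K d
  (u +i v) +ₖ (w +i z) = (u +ᵈ w) +i (v +ᵈ z)

  _*ₖ_ : K d → K d → K d
  (u +i v) *ₖ (w +i z) = (u *ᵈ w +ᵈ (-ᵈ (v *ᵈ z))) +i (u *ᵈ z +ᵈ v *ᵈ w)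

  ofℚ : ℚ → K d
  ofℚ p = ofℚᵈ p +i ofℚᵈ 0ℚ

  0ₖ 1ₖ : K d
  0ₖ = ofℚ 0ℚ
  1ₖ = ofℚ 1ℚ

  -- Monic polynomial with integer coefficients cs = [c₀, …, c_{n-1}]:
  -- evalMonic x cs = x^n + c_{n-1} x^{n-1} + … + c₀.
  evalMonic : K d → List ℤ → K d
  evalMonic x [] = 1ₖ
  evalMonic x (c ∷ cs) = ofℚ (c ℚ./ 1) +ₖ x *ₖ evalMonic x cs

  IsIntegral : K d → Set
  IsIntegral x = Σ (List ℤ) λ cs → evalMonic x cs ≡ 0ₖ

  SubsetK : Set₁
  SubsetK = K d → Set

  record IsFractionalIdeal (M : SubsetK) : Set where
    field
      zero-mem  : M 0ₖ
      +-closed  : ∀ {x y} → M x → M y → M (x +ₖ y)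
      *-closed  : ∀ {r x} → IsIntegral r → M x → M (r *ₖ x)
      nonzero   : Σ (K d) λ x → M x × ¬ (x ≡ 0ₖ)
      denom     : Σ (K d) λ r → IsIntegral r × ¬ (r ≡ 0ₖ)
                    × (∀ {x} → M x → IsIntegral (r *ₖ x))

  sumₖ : List (K d) → K d
  sumₖ = foldr _+ₖ_ 0ₖ

  _·ᴵ_ : SubsetK → SubsetK → SubsetK
  (I ·ᴵ J) z = Σ (List (K d × K d)) λ ps →
                 All (λ { (x , y) → I x × J y }) ps
                 × z ≡ sumₖ (map (λ { (x , y) → x *ₖ y }) ps)

  ⟨_⟩ : K d → SubsetK
  ⟨ α ⟩ z = Σ (K d) λ r → IsIntegral r × z ≡ α *ₖ r

  _≐_ : SubsetK → SubsetK → Set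
  I ≐ J = (∀ {z} → I z → J z) × (∀ {z} → J z → I z)

  IsPrincipal : SubsetK → Set
  IsPrincipal I = Σ (K d) λ α → ¬ (α ≡ 0ₖ) × I ≐ ⟨ α ⟩

  HasClassOrderTwo : SubsetK → Set
  HasClassOrderTwo H = IsPrincipal (H ·ᴵ H) × ¬ IsPrincipal H

{-# OPTIONS --safe #-}
module Submission where

-- H² = (α) with α = a + bi ≠ 0; suppose also H = (γ).  Then γ² = α r and α = γ² S with r, S integral,
-- so S r = 1.  Let τ be the automorphism of k fixing ℚ(√-d) (√d ↦ -√d, i ↦ -i).  Then v = r τ(r) is a unit
-- of ℚ(√-d); as d ≥ 2 is squarefree, v = ±1 or d = 3 and v is a sixth root of unity, and in all cases
-- v = ε w² with ε = ±1 and w w̄ = 1.  The element z = γ τ(γ) of ℚ(√-d) satisfies z² = α τ(α) v = (a² + b²) v,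
-- so u = z w̄ ∈ ℚ(√-d) has u² = ±(a² + b²).  Writing u = X + Y√-d forces X Y = 0, whence a² + b² is X² or
-- d Y², a square in ℚ(√d).

open import Defs
open import Level using (0ℓ)
open import Function using (_∘_)
open import Algebra using (CommutativeRing; AbelianGroup; Op₁; Op₂)
open import Data.Nat as ℕ using (ℕ; zero; suc; _≤_)
import Data.Nat.Properties as ℕP
open import Data.Nat.Coprimality as Cop using (Coprime)
open import Data.Nat.Divisibility using (_∣_; divides; ∣1⇒≡1; ∣-trans; *-pres-∣)
open import Data.Nat.Primality using (Prime; prime[2])
open import Data.Nat.Primality.Factorisation using (factorise)
open import Data.Nat.ListAction using (product)
open import Data.Integer as ℤ using (ℤ; +_; -[1+_]; ∣_∣)
import Data.Integer.Properties as ℤP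
open import Data.Rational as ℚ using (ℚ; mkℚ; 0ℚ; 1ℚ; ½; -½; _+_; _*_; _-_; -_)
import Data.Rational.Properties as ℚP
import Data.Rational.Unnormalised.Base as ℚᵘ
import Data.Rational.Unnormalised.Properties as ℚᵘP
open import Data.List using (List; []; _∷_; length; map)
open import Data.List.Relation.Unary.All using (All; []; _∷_)
open import Data.Product using (Σ; _×_; _,_; proj₁; proj₂)
open import Data.Sum using (_⊎_; inj₁; inj₂)
import Data.Maybe as Maybe
open import Relation.Nullary using (¬_; yes; no; contradiction)
open import Relation.Nullary.Decidable using (dec⇒maybe)
open import Relation.Binary.PropositionalEquality
import Algebra.Properties.Group (AbelianGroup.group ℤP.+-0-abelianGroup) as ℤ-Group
import Algebra.Properties.Group ℚP.+-0-group as ℚ-Group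
import Data.Nat.Tactic.RingSolver as ℕ-Solver
import Data.Integer.Tactic.RingSolver as ℤ-Solver
open import Tactic.RingSolver using (solve-∀)
open import Tactic.RingSolver.Core.AlmostCommutativeRing using (AlmostCommutativeRing) renaming (fromCommutativeRing to almostCommutativeRing)
open import Algebra.Solver.Ring.AlmostCommutativeRing using (fromCommutativeRing; _-Raw-AlmostCommutative⟶_)
import Algebra.Solver.Ring as RingSolver

module _ {A : Set} (_⊕_ _⊗_ : Op₂ A) (⊖_ : Op₁ A) (0# 1# : A) where
  open import Algebra.Definitions {A = A} _≡_
  open import Algebra.Consequences.Propositional {A = A}

  commutativeRing : Associative _⊕_ → Commutative _⊕_ → LeftIdentity 0# _⊕_ → LeftInverse 0# ⊖_ _⊕_ →
                    Associative _⊗_ → Commutative _⊗_ → LeftIdentity 1# _⊗_ → _⊗_ DistributesOverʳ _⊕_ →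
                    CommutativeRing 0ℓ 0ℓ
  commutativeRing ⊕-assoc ⊕-comm ⊕-identityˡ ⊖-inverseˡ ⊗-assoc ⊗-comm ⊗-identityˡ distribʳ = record
    { Carrier = A ; _≈_ = _≡_ ; _+_ = _⊕_ ; _*_ = _⊗_ ; -_ = ⊖_ ; 0# = 0# ; 1# = 1#
    ; isCommutativeRing = record
      { isRing = record
        { +-isAbelianGroup = record
          { isGroup = record
            { isMonoid = record
              { isSemigroup = record { isMagma = record { isEquivalence = isEquivalence ; ∙-cong = cong₂ _⊕_ } ; assoc = ⊕-assoc }
              ; identity = comm∧idˡ⇒id ⊕-comm ⊕-identityˡ }
            ; inverse = comm∧invˡ⇒inv ⊕-comm ⊖-inverseˡ
            ; ⁻¹-cong = cong ⊖_ }
          ; comm = ⊕-comm }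
        ; *-cong = cong₂ _⊗_
        ; *-assoc = ⊗-assoc
        ; *-identity = comm∧idˡ⇒id ⊗-comm ⊗-identityˡ
        ; distrib = comm∧distrʳ⇒distrˡ ⊗-comm distribʳ , distribʳ }
      ; *-comm = ⊗-comm } }

ℚ-ring : AlmostCommutativeRing 0ℓ 0ℓ
ℚ-ring = almostCommutativeRing ℚP.+-*-commutativeRing (λ x → dec⇒maybe (0ℚ ℚP.≟ x))

-- Integers in ℚ and the rational root theorem

fromℤ : ℤ → ℚ
fromℤ z = mkℚ z 0 (Cop.sym (Cop.1-coprimeTo ∣ z ∣))

fromℤ-injective : ∀ {m n} → fromℤ m ≡ fromℤ n → m ≡ n
fromℤ-injective = cong ℚ.numerator

fromℤ-+ : ∀ m n → fromℤ (m ℤ.+ n) ≡ fromℤ m + fromℤ n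
fromℤ-+ m n = ℚP.toℚᵘ-injective
  (ℚᵘP.≃-trans (ℚᵘ.*≡* (cross-multiplied m n)) (ℚᵘP.≃-sym (ℚP.toℚᵘ-homo-+ (fromℤ m) (fromℤ n))))
  where
  cross-multiplied : ∀ m n → (m ℤ.+ n) ℤ.* + 1 ≡ (m ℤ.* + 1 ℤ.+ n ℤ.* + 1) ℤ.* + 1
  cross-multiplied = ℤ-Solver.solve-∀

fromℤ-* : ∀ m n → fromℤ (m ℤ.* n) ≡ fromℤ m * fromℤ n
fromℤ-* m n = ℚP.toℚᵘ-injective (ℚᵘP.≃-sym (ℚP.toℚᵘ-homo-* (fromℤ m) (fromℤ n)))

fromℤ-neg : ∀ n → fromℤ (ℤ.- n) ≡ - fromℤ n
fromℤ-neg (+ zero) = refl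
fromℤ-neg (+ suc n) = refl
fromℤ-neg -[1+ n ] = refl

n/1≡fromℤ : ∀ n → n ℚ./ 1 ≡ fromℤ n
n/1≡fromℤ n = ℚP.↥p/↧p≡p (fromℤ n)

evalMonicℚ : ℚ → List ℤ → ℚ
evalMonicℚ x [] = 1ℚ
evalMonicℚ x (c ∷ cs) = c ℚ./ 1 + x * evalMonicℚ x cs

coprime-∣-^⇒≡1 : ∀ {q m} k → Coprime q m → q ∣ m ℕ.^ k → q ≡ 1
coprime-∣-^⇒≡1 zero    _   q∣1     = ∣1⇒≡1 q∣1
coprime-∣-^⇒≡1 (suc k) q⊥m q∣m^k+1 = coprime-∣-^⇒≡1 k q⊥m (Cop.coprime-divisor q⊥m q∣m^k+1)

∣^∣ : ∀ n k → ∣ n ℤ.^ k ∣ ≡ ∣ n ∣ ℕ.^ k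
∣^∣ n zero    = refl
∣^∣ n (suc k) = trans (ℤP.abs-* n (n ℤ.^ k)) (cong (∣ n ∣ ℕ.*_) (∣^∣ n k))

-- For x = n / Q in lowest terms and p of degree k, Q^k p(x) is the integer
-- n^k + Q (…); so p(x) = 0 forces Q ∣ n^k, hence Q = 1.
module RationalRoot (n : ℤ) (q : ℕ) .(n⊥q : Coprime ∣ n ∣ (suc q)) where
  private
    Q : ℤ
    Q = + suc q
    x : ℚ
    x = mkℚ n q n⊥q

  cleared tail : List ℤ → ℤ
  cleared []       = + 1
  cleared (a ∷ cs) = a ℤ.* Q ℤ.^ suc (length cs) ℤ.+ n ℤ.* cleared cs
  tail []       = + 0
  tail (a ∷ cs) = a ℤ.* Q ℤ.^ length cs ℤ.+ n ℤ.* tail cs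

  cleared≡n^k+Q*tail : ∀ cs → cleared cs ≡ n ℤ.^ length cs ℤ.+ Q ℤ.* tail cs
  cleared≡n^k+Q*tail []       = sym (cong (ℤ._+_ (+ 1)) (ℤP.*-zeroʳ Q))
  cleared≡n^k+Q*tail (a ∷ cs) rewrite cleared≡n^k+Q*tail cs =
    shuffle a Q (Q ℤ.^ length cs) n (n ℤ.^ length cs) (tail cs)
    where
    shuffle : ∀ a Q Qk n nk t → a ℤ.* (Q ℤ.* Qk) ℤ.+ n ℤ.* (nk ℤ.+ Q ℤ.* t) ≡ n ℤ.* nk ℤ.+ Q ℤ.* (a ℤ.* Qk ℤ.+ n ℤ.* t)
    shuffle = ℤ-Solver.solve-∀

  x*Q≡n : x * fromℤ Q ≡ fromℤ n
  x*Q≡n = ℚP.toℚᵘ-injective (ℚᵘP.≃-trans (ℚP.toℚᵘ-homo-* x (fromℤ Q)) (ℚᵘ.*≡* lemma))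
    where
    lemma : (n ℤ.* Q) ℤ.* + 1 ≡ n ℤ.* + suc (q ℕ.* 1)
    lemma rewrite ℕP.*-identityʳ q = ℤP.*-identityʳ _

  cleared-eval : ∀ cs → fromℤ (Q ℤ.^ length cs) * evalMonicℚ x cs ≡ fromℤ (cleared cs)
  cleared-eval []       = refl
  cleared-eval (a ∷ cs) = begin
    fromℤ (Q ℤ.* Qk) * (a ℚ./ 1 + x * E)
      ≡⟨ cong₂ _*_ (fromℤ-* Q Qk) (cong (_+ x * E) (n/1≡fromℤ a)) ⟩
    (fromℤ Q * fromℤ Qk) * (fromℤ a + x * E)
      ≡⟨ shuffle (fromℤ Q) (fromℤ Qk) (fromℤ a) x E ⟩
    fromℤ a * (fromℤ Q * fromℤ Qk) + (x * fromℤ Q) * (fromℤ Qk * E)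
      ≡⟨ cong₂ _+_ (cong (fromℤ a *_) (sym (fromℤ-* Q Qk))) (cong₂ _*_ x*Q≡n (cleared-eval cs)) ⟩
    fromℤ a * fromℤ (Q ℤ.* Qk) + fromℤ n * fromℤ (cleared cs)
      ≡⟨ sym (cong₂ _+_ (fromℤ-* a (Q ℤ.* Qk)) (fromℤ-* n (cleared cs))) ⟩
    fromℤ (a ℤ.* (Q ℤ.* Qk)) + fromℤ (n ℤ.* cleared cs)
      ≡⟨ sym (fromℤ-+ (a ℤ.* (Q ℤ.* Qk)) (n ℤ.* cleared cs)) ⟩
    fromℤ (a ℤ.* (Q ℤ.* Qk) ℤ.+ n ℤ.* cleared cs) ∎
    where
    open ≡-Reasoning
    Qk = Q ℤ.^ length cs
    E = evalMonicℚ x cs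
    shuffle : ∀ q k c x e → (q * k) * (c + x * e) ≡ c * (q * k) + (x * q) * (k * e)
    shuffle = solve-∀ ℚ-ring

  root⇒denominator≡1 : ∀ cs → evalMonicℚ x cs ≡ 0ℚ → q ≡ 0
  root⇒denominator≡1 cs root = ℕP.suc-injective (coprime-∣-^⇒≡1 k (Cop.sym (Cop.recompute n⊥q)) Q∣n^k)
    where
    k = length cs
    cleared≡0 : cleared cs ≡ + 0
    cleared≡0 = fromℤ-injective (trans (sym (cleared-eval cs))
                  (trans (cong (fromℤ (Q ℤ.^ k) *_) root) (ℚP.*-zeroʳ (fromℤ (Q ℤ.^ k)))))
    n^k≡-Q*tail : n ℤ.^ k ≡ ℤ.- (Q ℤ.* tail cs)
    n^k≡-Q*tail = ℤ-Group.inverseˡ-unique (n ℤ.^ k) (Q ℤ.* tail cs) (trans (sym (cleared≡n^k+Q*tail cs)) cleared≡0)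
    Q∣n^k : suc q ∣ ∣ n ∣ ℕ.^ k
    Q∣n^k = divides ∣ tail cs ∣ (begin
      ∣ n ∣ ℕ.^ k             ≡⟨ sym (∣^∣ n k) ⟩
      ∣ n ℤ.^ k ∣             ≡⟨ cong ∣_∣ n^k≡-Q*tail ⟩
      ∣ ℤ.- (Q ℤ.* tail cs) ∣ ≡⟨ ℤP.∣-i∣≡∣i∣ (Q ℤ.* tail cs) ⟩
      ∣ Q ℤ.* tail cs ∣       ≡⟨ ℤP.abs-* Q (tail cs) ⟩
      suc q ℕ.* ∣ tail cs ∣   ≡⟨ ℕP.*-comm (suc q) ∣ tail cs ∣ ⟩
      ∣ tail cs ∣ ℕ.* suc q   ∎)
      where open ≡-Reasoning

rational-root-theorem : ∀ x cs → evalMonicℚ x cs ≡ 0ℚ → Σ ℤ λ z → x ≡ fromℤ z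
rational-root-theorem (mkℚ n q n⊥q) cs root = n , ℚP.mkℚ-cong refl (RationalRoot.root⇒denominator≡1 n q n⊥q cs root)

prime-factor : ∀ n → 2 ≤ n → Σ ℕ λ p → Prime p × p ∣ n
prime-factor n@(suc _) 2≤n with factorise n
... | record { factors = [] ; isFactorisation = n≡1 } = contradiction n≡1 (ℕP.>⇒≢ 2≤n)
... | record { factors = p ∷ ps ; isFactorisation = n≡p*Πps ; factorsPrime = p-prime ∷ _ } =
  p , p-prime , divides (product ps) (trans n≡p*Πps (ℕP.*-comm p (product ps)))

squarefree-square-divisor : ∀ {d} → SquareFree d → ∀ q → suc q ℕ.* suc q ∣ d → q ≡ 0
squarefree-square-divisor sf zero    _     = refl
squarefree-square-divisor sf (suc q) ss∣d with prime-factor (2 ℕ.+ q) (ℕ.s≤s (ℕ.s≤s ℕ.z≤n))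
... | p , p-prime , p∣s = contradiction (∣-trans (*-pres-∣ p∣s p∣s) ss∣d) (sf p p-prime)

coprime-∣-m*m*⇒∣ : ∀ {s m x} → Coprime s m → s ∣ m ℕ.* (m ℕ.* x) → s ∣ x
coprime-∣-m*m*⇒∣ s⊥m = Cop.coprime-divisor s⊥m ∘ Cop.coprime-divisor s⊥m

-- s ∣ d m² with s ⊥ m gives d = e s; then s ∣ e m² gives e = f s, so s² ∣ d.
squarefree-denominator : ∀ {d} → SquareFree d → ∀ q m k → Coprime (suc q) m →
                         d ℕ.* (m ℕ.* m) ≡ k ℕ.* (suc q ℕ.* suc q) → q ≡ 0
squarefree-denominator {d} sf q m k s⊥m dm²≡ks²
  with coprime-∣-m*m*⇒∣ s⊥m (divides (k ℕ.* suc q) (trans (rearrange m d) dm²≡ks²s))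
  where
  dm²≡ks²s : d ℕ.* (m ℕ.* m) ≡ k ℕ.* suc q ℕ.* suc q
  dm²≡ks²s = trans dm²≡ks² (sym (ℕP.*-assoc k (suc q) (suc q)))
  rearrange : ∀ m d → m ℕ.* (m ℕ.* d) ≡ d ℕ.* (m ℕ.* m)
  rearrange = ℕ-Solver.solve-∀
... | divides e refl
  with coprime-∣-m*m*⇒∣ s⊥m (divides k (ℕP.*-cancelʳ-≡ _ _ (suc q) (trans (rearrange m e (suc q)) esm²≡ks²s)))
  where
  esm²≡ks²s : e ℕ.* suc q ℕ.* (m ℕ.* m) ≡ k ℕ.* suc q ℕ.* suc q
  esm²≡ks²s = trans dm²≡ks² (sym (ℕP.*-assoc k (suc q) (suc q)))
  rearrange : ∀ m e s → m ℕ.* (m ℕ.* e) ℕ.* s ≡ e ℕ.* s ℕ.* (m ℕ.* m)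
  rearrange = ℕ-Solver.solve-∀
... | divides f refl = squarefree-square-divisor sf q (divides f (ℕP.*-assoc f (suc q) (suc q)))

squarefree-rational-root : ∀ {d} → SquareFree d → ∀ t z → fromℤ (+ d) * (t * t) ≡ fromℤ z → Σ ℤ λ k → t ≡ fromℤ k
squarefree-rational-root {d} sf t@(mkℚ n q n⊥q) z dt²≡z =
  n , ℚP.mkℚ-cong refl (squarefree-denominator sf q ∣ n ∣ ∣ z ∣ (Cop.sym (Cop.recompute n⊥q)) dn²≡zQ²)
  where
  open ≡-Reasoning
  Q = + suc q
  x*Q≡n : t * fromℤ Q ≡ fromℤ n
  x*Q≡n = RationalRoot.x*Q≡n n q n⊥q
  integral : + d ℤ.* (n ℤ.* n) ≡ z ℤ.* (Q ℤ.* Q)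
  integral = fromℤ-injective (begin
    fromℤ (+ d ℤ.* (n ℤ.* n))                ≡⟨ trans (fromℤ-* (+ d) (n ℤ.* n)) (cong (fromℤ (+ d) *_) (fromℤ-* n n)) ⟩
    fromℤ (+ d) * (fromℤ n * fromℤ n)        ≡⟨ cong (λ u → fromℤ (+ d) * (u * u)) x*Q≡n ⟨
    fromℤ (+ d) * ((t * fromℤ Q) * (t * fromℤ Q)) ≡⟨ shuffle (fromℤ (+ d)) t (fromℤ Q) ⟩
    (fromℤ (+ d) * (t * t)) * (fromℤ Q * fromℤ Q) ≡⟨ cong₂ _*_ dt²≡z (sym (fromℤ-* Q Q)) ⟩
    fromℤ z * fromℤ (Q ℤ.* Q)                ≡⟨ fromℤ-* z (Q ℤ.* Q) ⟨
    fromℤ (z ℤ.* (Q ℤ.* Q))                  ∎)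
    where
    shuffle : ∀ D t q → D * ((t * q) * (t * q)) ≡ (D * (t * t)) * (q * q)
    shuffle = solve-∀ ℚ-ring
  dn²≡zQ² : d ℕ.* (∣ n ∣ ℕ.* ∣ n ∣) ≡ ∣ z ∣ ℕ.* (suc q ℕ.* suc q)
  dn²≡zQ² = begin
    d ℕ.* (∣ n ∣ ℕ.* ∣ n ∣)   ≡⟨ cong (d ℕ.*_) (ℤP.abs-* n n) ⟨
    d ℕ.* ∣ n ℤ.* n ∣         ≡⟨ ℤP.abs-* (+ d) (n ℤ.* n) ⟨
    ∣ + d ℤ.* (n ℤ.* n) ∣     ≡⟨ cong ∣_∣ integral ⟩
    ∣ z ℤ.* (Q ℤ.* Q) ∣       ≡⟨ trans (ℤP.abs-* z (Q ℤ.* Q)) (cong (∣ z ∣ ℕ.*_) (ℤP.abs-* Q Q)) ⟩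
    ∣ z ∣ ℕ.* (suc q ℕ.* suc q) ∎

0≤*-nonNeg : ∀ {p q} → 0ℚ ℚ.≤ p → 0ℚ ℚ.≤ q → 0ℚ ℚ.≤ p * q
0≤*-nonNeg {p} {q} 0≤p 0≤q =
  ℚP.nonNegative⁻¹ (p * q) {{ℚP.nonNeg*nonNeg⇒nonNeg p {{ℚ.nonNegative 0≤p}} q {{ℚ.nonNegative 0≤q}}}}

0≤+-nonNeg : ∀ {p q} → 0ℚ ℚ.≤ p → 0ℚ ℚ.≤ q → 0ℚ ℚ.≤ p + q
0≤+-nonNeg 0≤p 0≤q = ℚP.+-mono-≤ 0≤p 0≤q

0≤p*p : ∀ p → 0ℚ ℚ.≤ p * p
0≤p*p p with ℚP.≤-total 0ℚ p
... | inj₁ 0≤p = 0≤*-nonNeg 0≤p 0≤p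
... | inj₂ p≤0 = ℚP.nonNegative⁻¹ (p * p) {{ℚP.nonPos*nonPos⇒nonPos p {{ℚ.nonPositive p≤0}} p {{ℚ.nonPositive p≤0}}}}

nonNeg+nonNeg≡0⇒≡0 : ∀ {p q} → 0ℚ ℚ.≤ p → 0ℚ ℚ.≤ q → p + q ≡ 0ℚ → p ≡ 0ℚ
nonNeg+nonNeg≡0⇒≡0 {p} 0≤p 0≤q p+q≡0 =
  ℚP.≤-antisym (subst₂ ℚ._≤_ (ℚP.+-identityʳ p) p+q≡0 (ℚP.+-monoʳ-≤ p 0≤q)) 0≤p

0≤fromℤ⇒ℕ : ∀ z → 0ℚ ℚ.≤ fromℤ z → Σ ℕ λ k → z ≡ + k
0≤fromℤ⇒ℕ (+ k)    _            = k , refl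
0≤fromℤ⇒ℕ -[1+ k ] (ℚ.*≤* ())

*≡0⇒≡0⊎≡0 : ∀ p q → p * q ≡ 0ℚ → p ≡ 0ℚ ⊎ q ≡ 0ℚ
*≡0⇒≡0⊎≡0 p q pq≡0 with p ℚP.≟ 0ℚ
... | yes p≡0 = inj₁ p≡0
... | no  p≢0 = inj₂ (begin
  q              ≡⟨ ℚP.*-identityˡ q ⟨
  1ℚ * q         ≡⟨ cong (_* q) (ℚP.*-inverseˡ p {{ℚ.≢-nonZero p≢0}}) ⟨
  p⁻¹ * p * q    ≡⟨ ℚP.*-assoc p⁻¹ p q ⟩
  p⁻¹ * (p * q)  ≡⟨ cong (p⁻¹ *_) pq≡0 ⟩
  p⁻¹ * 0ℚ       ≡⟨ ℚP.*-zeroʳ p⁻¹ ⟩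
  0ℚ             ∎)
  where
  open ≡-Reasoning
  p⁻¹ = (ℚ.1/ p) {{ℚ.≢-nonZero p≢0}}

∣z∣²≡z² : ∀ z → + (∣ z ∣ ℕ.* ∣ z ∣) ≡ z ℤ.* z
∣z∣²≡z² (+ n)    = ℤP.pos-* n n
∣z∣²≡z² -[1+ n ] = refl

4≤[2+k]² : ∀ k → 4 ≤ (2 ℕ.+ k) ℕ.* (2 ℕ.+ k)
4≤[2+k]² k = ℕP.*-mono-≤ {2} {2 ℕ.+ k} (ℕP.m≤m+n 2 k) (ℕP.m≤m+n 2 k)

sum-of-squares≡4 : ∀ {d} → 2 ≤ d → SquareFree d → ∀ m n → m ℕ.* m ℕ.+ d ℕ.* (n ℕ.* n) ≡ 4 →
                   (n ≡ 0 × m ≡ 2) ⊎ (d ≡ 3 × n ≡ 1 × m ≡ 1)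
sum-of-squares≡4 {d} 2≤d sf m zero eq rewrite ℕP.*-zeroʳ d | ℕP.+-identityʳ (m ℕ.* m) = inj₁ (refl , root m eq)
  where
  root : ∀ m → m ℕ.* m ≡ 4 → m ≡ 2
  root 2 _ = refl
  root (suc (suc (suc k))) eq = contradiction eq
    (ℕP.>⇒≢ (ℕP.<-≤-trans (ℕP.m≤m+n 5 4) (ℕP.*-mono-≤ {3} {3 ℕ.+ k} (ℕP.m≤m+n 3 k) (ℕP.m≤m+n 3 k))))
sum-of-squares≡4 {d} 2≤d sf zero (suc zero) eq =
  contradiction (divides 1 (trans (sym (ℕP.*-identityʳ d)) eq)) (sf 2 prime[2])
sum-of-squares≡4 {d} 2≤d sf (suc zero) (suc zero) eq =
  inj₂ (ℕP.suc-injective (trans (cong suc (sym (ℕP.*-identityʳ d))) eq) , refl , refl)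
sum-of-squares≡4 {d} 2≤d sf (suc (suc k)) (suc zero) eq = contradiction eq (ℕP.>⇒≢ (begin-strict
  4                                    <⟨ ℕP.m≤m+n 5 1 ⟩
  4 ℕ.+ 2                              ≤⟨ ℕP.+-mono-≤ (4≤[2+k]² k) (ℕP.≤-trans 2≤d (ℕP.≤-reflexive (sym (ℕP.*-identityʳ d)))) ⟩
  (2 ℕ.+ k) ℕ.* (2 ℕ.+ k) ℕ.+ d ℕ.* 1   ∎))
  where open ℕP.≤-Reasoning
sum-of-squares≡4 {d} 2≤d sf m (suc (suc k)) eq = contradiction eq (ℕP.>⇒≢ (begin-strict
  4                                        <⟨ ℕP.m≤m+n 5 3 ⟩
  8                                        ≤⟨ ℕP.*-mono-≤ {2} {d} {4} 2≤d (4≤[2+k]² k) ⟩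
  d ℕ.* ((2 ℕ.+ k) ℕ.* (2 ℕ.+ k))          ≤⟨ ℕP.m≤n+m _ (m ℕ.* m) ⟩
  m ℕ.* m ℕ.+ d ℕ.* ((2 ℕ.+ k) ℕ.* (2 ℕ.+ k)) ∎))
  where open ℕP.≤-Reasoning

-- Arithmetic of k = ℚ(√d)(i)

module _ {d : ℕ} where
  -- The ℚ identities below quantify over D = dℚ, which the ring solver could not treat as a variable.
  QD-commutativeRing : CommutativeRing 0ℓ 0ℓ
  QD-commutativeRing = commutativeRing (_+ᵈ_ {d}) _*ᵈ_ -ᵈ_ (ofℚᵈ 0ℚ) (ofℚᵈ 1ℚ)
    (λ { (p +√ q) (r +√ s) (t +√ u) → cong₂ _+√_ (ℚP.+-assoc p r t) (ℚP.+-assoc q s u) })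
    (λ { (p +√ q) (r +√ s) → cong₂ _+√_ (ℚP.+-comm p r) (ℚP.+-comm q s) })
    (λ { (p +√ q) → cong₂ _+√_ (ℚP.+-identityˡ p) (ℚP.+-identityˡ q) })
    (λ { (p +√ q) → cong₂ _+√_ (ℚP.+-inverseˡ p) (ℚP.+-inverseˡ q) })
    (λ { (p +√ q) (r +√ s) (t +√ u) → cong₂ _+√_ (*-assoc-re (dℚ {d}) p q r s t u) (*-assoc-sq (dℚ {d}) p q r s t u) })
    (λ { (p +√ q) (r +√ s) → cong₂ _+√_ (*-comm-re (dℚ {d}) p q r s) (*-comm-sq p q r s) })
    (λ { (p +√ q) → cong₂ _+√_ (*-identityˡ-re (dℚ {d}) p q) (*-identityˡ-sq p q) })
    (λ { (p +√ q) (r +√ s) (t +√ u) → cong₂ _+√_ (distribʳ-re (dℚ {d}) p q r s t u) (distribʳ-sq p q r s t u) })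
    where
    *-assoc-re : ∀ D p q r s t u → (p * r + D * (q * s)) * t + D * ((p * s + q * r) * u) ≡
                                   p * (r * t + D * (s * u)) + D * (q * (r * u + s * t))
    *-assoc-re = solve-∀ ℚ-ring
    *-assoc-sq : ∀ D p q r s t u → (p * r + D * (q * s)) * u + (p * s + q * r) * t ≡
                                   p * (r * u + s * t) + q * (r * t + D * (s * u))
    *-assoc-sq = solve-∀ ℚ-ring
    *-comm-re : ∀ D p q r s → p * r + D * (q * s) ≡ r * p + D * (s * q)
    *-comm-re = solve-∀ ℚ-ring
    *-comm-sq : ∀ p q r s → p * s + q * r ≡ r * q + s * p
    *-comm-sq = solve-∀ ℚ-ring
    *-identityˡ-re : ∀ D p q → 1ℚ * p + D * (0ℚ * q) ≡ p
    *-identityˡ-re = solve-∀ ℚ-ring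
    *-identityˡ-sq : ∀ p q → 1ℚ * q + 0ℚ * p ≡ q
    *-identityˡ-sq = solve-∀ ℚ-ring
    distribʳ-re : ∀ D p q r s t u → (r + t) * p + D * ((s + u) * q) ≡ (r * p + D * (s * q)) + (t * p + D * (u * q))
    distribʳ-re = solve-∀ ℚ-ring
    distribʳ-sq : ∀ p q r s t u → (r + t) * q + (s + u) * p ≡ (r * q + s * p) + (t * q + u * p)
    distribʳ-sq = solve-∀ ℚ-ring

  conj : QD d → QD d
  conj (p +√ q) = p +√ (- q)

  conj-+ : ∀ x y → conj (x +ᵈ y) ≡ conj x +ᵈ conj y
  conj-+ (p +√ q) (r +√ s) = cong ((p + r) +√_) (ℚP.neg-distrib-+ q s)

  conj-neg : ∀ x → conj (-ᵈ x) ≡ -ᵈ conj x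
  conj-neg (p +√ q) = refl

  conj-* : ∀ x y → conj (x *ᵈ y) ≡ conj x *ᵈ conj y
  conj-* (p +√ q) (r +√ s) = cong₂ _+√_ (re-part (dℚ {d}) p q r s) (sq-part p q r s)
    where
    re-part : ∀ D p q r s → p * r + D * (q * s) ≡ p * r + D * (- q * - s)
    re-part = solve-∀ ℚ-ring
    sq-part : ∀ p q r s → - (p * s + q * r) ≡ p * - s + - q * r
    sq-part = solve-∀ ℚ-ring

  ofℚᵈ-* : ∀ p q → ofℚᵈ {d} (p * q) ≡ ofℚᵈ p *ᵈ ofℚᵈ q
  ofℚᵈ-* p q = cong₂ _+√_ (re-part (dℚ {d}) p q) (sq-part p q)
    where
    re-part : ∀ D p q → p * q ≡ p * q + D * (0ℚ * 0ℚ)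
    re-part = solve-∀ ℚ-ring
    sq-part : ∀ p q → 0ℚ ≡ p * 0ℚ + 0ℚ * q
    sq-part = solve-∀ ℚ-ring

  ofℚᵈ-morphism : ℚP.+-*-rawRing -Raw-AlmostCommutative⟶ fromCommutativeRing QD-commutativeRing
  ofℚᵈ-morphism = record
    { ⟦_⟧ = ofℚᵈ {d} ; +-homo = λ _ _ → refl ; *-homo = ofℚᵈ-* ; -‿homo = λ _ → refl ; 0-homo = refl ; 1-homo = refl }

  -- A solver over ℚ(√d) with rational coefficients: with coefficients in ℚ(√d) itself, coefficient
  -- arithmetic gets stuck on the symbolic d.
  module QD-Solver = RingSolver ℚP.+-*-rawRing (fromCommutativeRing QD-commutativeRing) ofℚᵈ-morphism
                       (λ p q → Maybe.map (cong ofℚᵈ) (dec⇒maybe (p ℚP.≟ q)))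

  private module ℚ√d = CommutativeRing QD-commutativeRing

  -ₖ_ : K d → K d
  -ₖ (u +i v) = (-ᵈ u) +i (-ᵈ v)

  K-commutativeRing : CommutativeRing 0ℓ 0ℓ
  K-commutativeRing = commutativeRing _+ₖ_ _*ₖ_ -ₖ_ 0ₖ 1ₖ
    (λ { (u +i v) (w +i z) (s +i t) → cong₂ _+i_ (ℚ√d.+-assoc u w s) (ℚ√d.+-assoc v z t) })
    (λ { (u +i v) (w +i z) → cong₂ _+i_ (ℚ√d.+-comm u w) (ℚ√d.+-comm v z) })
    (λ { (u +i v) → cong₂ _+i_ (ℚ√d.+-identityˡ u) (ℚ√d.+-identityˡ v) })
    (λ { (u +i v) → cong₂ _+i_ (ℚ√d.-‿inverseˡ u) (ℚ√d.-‿inverseˡ v) })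
    (λ { (u +i v) (w +i z) (s +i t) → cong₂ _+i_
      (solve 6 (λ u v w z s t → (u :* w :- v :* z) :* s :- (u :* z :+ v :* w) :* t
                             := u :* (w :* s :- z :* t) :- v :* (w :* t :+ z :* s)) refl u v w z s t)
      (solve 6 (λ u v w z s t → (u :* w :- v :* z) :* t :+ (u :* z :+ v :* w) :* s
                             := u :* (w :* t :+ z :* s) :+ v :* (w :* s :- z :* t)) refl u v w z s t) })
    (λ { (u +i v) (w +i z) → cong₂ _+i_
      (solve 4 (λ u v w z → u :* w :- v :* z := w :* u :- z :* v) refl u v w z)
      (solve 4 (λ u v w z → u :* z :+ v :* w := w :* v :+ z :* u) refl u v w z) })
    (λ { (u +i v) → cong₂ _+i_
      (solve 2 (λ u v → con 1ℚ :* u :- con 0ℚ :* v := u) refl u v)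
      (solve 2 (λ u v → con 1ℚ :* v :+ con 0ℚ :* u := v) refl u v) })
    (λ { (u +i v) (w +i z) (s +i t) → cong₂ _+i_
      (solve 6 (λ u v w z s t → (w :+ s) :* u :- (z :+ t) :* v := (w :* u :- z :* v) :+ (s :* u :- t :* v)) refl u v w z s t)
      (solve 6 (λ u v w z s t → (w :+ s) :* v :+ (z :+ t) :* u := (w :* v :+ z :* u) :+ (s :* v :+ t :* u)) refl u v w z s t) })
    where open QD-Solver

  ofℚ-* : ∀ p q → ofℚ {d} (p * q) ≡ ofℚ p *ₖ ofℚ q
  ofℚ-* p q = cong₂ _+i_
    (trans (ofℚᵈ-* p q) (solve 2 (λ x y → x :* y := x :* y :- con 0ℚ :* con 0ℚ) refl (ofℚᵈ p) (ofℚᵈ q)))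
    (solve 2 (λ x y → con 0ℚ := x :* con 0ℚ :+ con 0ℚ :* y) refl (ofℚᵈ p) (ofℚᵈ q))
    where open QD-Solver

  private module k = CommutativeRing K-commutativeRing

  x*1²≡x : ∀ x → x *ₖ (1ₖ *ₖ 1ₖ) ≡ x
  x*1²≡x x = trans (cong (x *ₖ_) (k.*-identityˡ 1ₖ)) (k.*-identityʳ x)

  record IsℚEndomorphism (f : K d → K d) : Set where
    field
      +-homo : ∀ x y → f (x +ₖ y) ≡ f x +ₖ f y
      *-homo : ∀ x y → f (x *ₖ y) ≡ f x *ₖ f y
      ofℚ-fixed : ∀ p → f (ofℚ p) ≡ ofℚ p

  ∘-isℚEndomorphism : ∀ {f g} → IsℚEndomorphism f → IsℚEndomorphism g → IsℚEndomorphism (f ∘ g)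
  ∘-isℚEndomorphism {f} {g} F G = record
    { +-homo = λ x y → trans (cong f (G.+-homo x y)) (F.+-homo (g x) (g y))
    ; *-homo = λ x y → trans (cong f (G.*-homo x y)) (F.*-homo (g x) (g y))
    ; ofℚ-fixed = λ p → trans (cong f (G.ofℚ-fixed p)) (F.ofℚ-fixed p) }
    where
    module F = IsℚEndomorphism F
    module G = IsℚEndomorphism G

  -- σ : i ↦ -i and ρ : √d ↦ -√d; τ = σ ∘ ρ fixes √-d = √d i, and its fixed field is ℚ(√-d).
  σ ρ τ : K d → K d
  σ (u +i v) = u +i (-ᵈ v)
  ρ (u +i v) = conj u +i conj v
  τ = σ ∘ ρ

  σ-isℚEndomorphism : IsℚEndomorphism σ
  σ-isℚEndomorphism = record
    { +-homo = λ { (u +i v) (w +i z) → cong ((u +ᵈ w) +i_) (solve 2 (λ v z → :- (v :+ z) := :- v :- z) refl v z) }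
    ; *-homo = λ { (u +i v) (w +i z) → cong₂ _+i_
        (solve 4 (λ u v w z → u :* w :- v :* z := u :* w :- (:- v) :* (:- z)) refl u v w z)
        (solve 4 (λ u v w z → :- (u :* z :+ v :* w) := u :* (:- z) :+ (:- v) :* w) refl u v w z) }
    ; ofℚ-fixed = λ _ → refl }
    where open QD-Solver

  ρ-isℚEndomorphism : IsℚEndomorphism ρ
  ρ-isℚEndomorphism = record
    { +-homo = λ { (u +i v) (w +i z) → cong₂ _+i_ (conj-+ u w) (conj-+ v z) }
    ; *-homo = λ { (u +i v) (w +i z) → cong₂ _+i_
        (trans (conj-+ (u *ᵈ w) _) (cong₂ _+ᵈ_ (conj-* u w) (trans (conj-neg (v *ᵈ z)) (cong -ᵈ_ (conj-* v z)))))
        (trans (conj-+ (u *ᵈ z) _) (cong₂ _+ᵈ_ (conj-* u z) (conj-* v w))) }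
    ; ofℚ-fixed = λ _ → refl }

  τ-isℚEndomorphism : IsℚEndomorphism τ
  τ-isℚEndomorphism = ∘-isℚEndomorphism σ-isℚEndomorphism ρ-isℚEndomorphism

  module _ {f : K d → K d} (F : IsℚEndomorphism f) where
    open IsℚEndomorphism F

    evalMonic-homo : ∀ x cs → f (evalMonic x cs) ≡ evalMonic (f x) cs
    evalMonic-homo x []       = ofℚ-fixed 1ℚ
    evalMonic-homo x (c ∷ cs) = begin
      f (ofℚ (c ℚ./ 1) +ₖ x *ₖ evalMonic x cs)       ≡⟨ +-homo _ _ ⟩
      f (ofℚ (c ℚ./ 1)) +ₖ f (x *ₖ evalMonic x cs)    ≡⟨ cong₂ _+ₖ_ (ofℚ-fixed _) (*-homo x _) ⟩
      ofℚ (c ℚ./ 1) +ₖ f x *ₖ f (evalMonic x cs)      ≡⟨ cong (λ e → ofℚ (c ℚ./ 1) +ₖ f x *ₖ e) (evalMonic-homo x cs) ⟩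
      ofℚ (c ℚ./ 1) +ₖ f x *ₖ evalMonic (f x) cs      ∎
      where open ≡-Reasoning

    integral-preserved : ∀ {x} → IsIntegral x → IsIntegral (f x)
    integral-preserved {x} (cs , px≡0) = cs , trans (sym (evalMonic-homo x cs)) (trans (cong f px≡0) (ofℚ-fixed 0ℚ))

  ofℚ-injective : ∀ {p q} → ofℚ {d} p ≡ ofℚ q → p ≡ q
  ofℚ-injective = cong (re ∘ realPart)

  evalMonic-ofℚ : ∀ x cs → evalMonic (ofℚ {d} x) cs ≡ ofℚ (evalMonicℚ x cs)
  evalMonic-ofℚ x []       = refl
  evalMonic-ofℚ x (c ∷ cs) = cong (ofℚ (c ℚ./ 1) +ₖ_) (trans (cong (ofℚ x *ₖ_) (evalMonic-ofℚ x cs)) (sym (ofℚ-* x _)))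

  integral-ofℚ⇒ℤ : ∀ {x} → IsIntegral (ofℚ {d} x) → Σ ℤ λ z → x ≡ fromℤ z
  integral-ofℚ⇒ℤ {x} (cs , px≡0) = rational-root-theorem x cs (ofℚ-injective (trans (sym (evalMonic-ofℚ x cs)) px≡0))

  0-integral : IsIntegral 0ₖ
  0-integral = (+ 0 ∷ []) , trans (cong (0ₖ +ₖ_) (k.zeroˡ 1ₖ)) (k.+-identityʳ 0ₖ)

  1-integral : IsIntegral 1ₖ
  1-integral = (-[1+ 0 ] ∷ []) , cong (ofℚ (- 1ℚ) +ₖ_) (k.*-identityˡ 1ₖ)

  infix 5 _+√-d_
  _+√-d_ : ℚ → ℚ → K d
  P +√-d Q = (P +√ 0ℚ) +i (0ℚ +√ Q)

  Inℚ√-d : K d → Set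
  Inℚ√-d z = Σ ℚ λ P → Σ ℚ λ Q → z ≡ P +√-d Q

  -p≡p⇒p≡0 : ∀ {p} → - p ≡ p → p ≡ 0ℚ
  -p≡p⇒p≡0 {p} -p≡p = begin
    p               ≡⟨ half p ⟩
    (p + p) * ½     ≡⟨ cong (λ t → (t + p) * ½) -p≡p ⟨
    (- p + p) * ½   ≡⟨ cong (_* ½) (ℚP.+-inverseˡ p) ⟩
    0ℚ              ∎
    where
    open ≡-Reasoning
    half : ∀ p → p ≡ (p + p) * ½
    half = solve-∀ ℚ-ring

  τ-fixed⇒Inℚ√-d : ∀ {z} → τ z ≡ z → Inℚ√-d z
  τ-fixed⇒Inℚ√-d {(a +√ b) +i (c +√ e)} τz≡z =
    a , e , cong₂ _+i_ (cong (a +√_) (-p≡p⇒p≡0 (cong (sq ∘ realPart) τz≡z)))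
                       (cong (_+√ e) (-p≡p⇒p≡0 (cong (re ∘ imagPart) τz≡z)))

  τ-involutive : ∀ z → τ (τ z) ≡ z
  τ-involutive ((a +√ b) +i (c +√ e)) =
    cong₂ _+i_ (cong (a +√_) (⁻¹-involutive b))
               (cong₂ _+√_ (⁻¹-involutive c) (trans (⁻¹-involutive _) (⁻¹-involutive e)))
    where open ℚ-Group using (⁻¹-involutive)

  *-τ-self-τ-fixed : ∀ x → τ (x *ₖ τ x) ≡ x *ₖ τ x
  *-τ-self-τ-fixed x = begin
    τ (x *ₖ τ x)      ≡⟨ IsℚEndomorphism.*-homo τ-isℚEndomorphism x (τ x) ⟩
    τ x *ₖ τ (τ x)    ≡⟨ cong (τ x *ₖ_) (τ-involutive x) ⟩
    τ x *ₖ x          ≡⟨ k.*-comm (τ x) x ⟩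
    x *ₖ τ x          ∎
    where open ≡-Reasoning

  +√-d-* : ∀ P Q R S → (P +√-d Q) *ₖ (R +√-d S) ≡ (P * R - dℚ {d} * (Q * S)) +√-d (P * S + Q * R)
  +√-d-* P Q R S = cong₂ _+i_
    (cong₂ _+√_ (real-real (dℚ {d}) P Q R S) (real-√d P Q R S))
    (cong₂ _+√_ (imag-real (dℚ {d}) P Q R S) (imag-√d P Q R S))
    where
    real-real : ∀ D P Q R S → P * R + D * (0ℚ * 0ℚ) + - (0ℚ * 0ℚ + D * (Q * S)) ≡ P * R - D * (Q * S)
    real-real = solve-∀ ℚ-ring
    real-√d : ∀ P Q R S → P * 0ℚ + 0ℚ * R + - (0ℚ * S + Q * 0ℚ) ≡ 0ℚ
    real-√d = solve-∀ ℚ-ring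
    imag-real : ∀ D P Q R S → P * 0ℚ + D * (0ℚ * S) + (0ℚ * R + D * (Q * 0ℚ)) ≡ 0ℚ
    imag-real = solve-∀ ℚ-ring
    imag-√d : ∀ P Q R S → P * S + 0ℚ * 0ℚ + (0ℚ * 0ℚ + Q * R) ≡ P * S + Q * R
    imag-√d = solve-∀ ℚ-ring

  norm-+√-d : ∀ P Q → (P +√-d Q) *ₖ σ (P +√-d Q) ≡ ofℚ (P * P + dℚ {d} * (Q * Q))
  norm-+√-d P Q = trans (+√-d-* P Q P (- Q)) (cong₂ _+√-d_ (real (dℚ {d}) P Q) (imag P Q))
    where
    real : ∀ D P Q → P * P - D * (Q * - Q) ≡ P * P + D * (Q * Q)
    real = solve-∀ ℚ-ring
    imag : ∀ P Q → P * - Q + Q * P ≡ 0ℚ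
    imag = solve-∀ ℚ-ring

  trace-+√-d : ∀ P Q → (P +√-d Q) +ₖ σ (P +√-d Q) ≡ ofℚ (P + P)
  trace-+√-d P Q = cong (λ t → ((P + P) +√ 0ℚ) +i (0ℚ +√ t)) (ℚP.+-inverseʳ Q)

-- Units of ℚ(√-d)

record IntegralsClosed (d : ℕ) : Set where
  field
    *-closed : ∀ {x y : K d} → IsIntegral x → IsIntegral y → IsIntegral (x *ₖ y)
    +-closed : ∀ {x y : K d} → IsIntegral x → IsIntegral y → IsIntegral (x +ₖ y)

SignedSquare : ∀ {d} → K d → Set
SignedSquare {d} v = Σ ℚ λ ε → Σ (K d) λ w →
  (ε ≡ 1ℚ ⊎ ε ≡ - 1ℚ) × Inℚ√-d w × v ≡ ofℚ ε *ₖ (w *ₖ w) × w *ₖ σ w ≡ 1ₖ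

∣i∣≡1+n⇒ : ∀ i n → ∣ i ∣ ≡ suc n → i ≡ + suc n ⊎ i ≡ -[1+ n ]
∣i∣≡1+n⇒ (+ _)    n refl = inj₁ refl
∣i∣≡1+n⇒ -[1+ _ ] n refl = inj₂ refl

-- ω = (-1 + √-3)/2 is a cube root of unity, so the units ±ω = ±(ω²)² and ±ω² of ℚ(√-3) are ± squares.
ω ω² : K 3
ω  = -½ +√-d ½
ω² = -½ +√-d -½

unit-signed-square : ∀ {d} m n → (∣ n ∣ ≡ 0 × ∣ m ∣ ≡ 2) ⊎ (d ≡ 3 × ∣ n ∣ ≡ 1 × ∣ m ∣ ≡ 1) →
                     SignedSquare {d} (fromℤ m * ½ +√-d fromℤ n * ½)
unit-signed-square {d} m n (inj₁ (∣n∣≡0 , ∣m∣≡2)) with ℤP.∣i∣≡0⇒i≡0 {n} ∣n∣≡0 | ∣i∣≡1+n⇒ m 1 ∣m∣≡2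
... | refl | inj₁ refl = 1ℚ , 1ₖ , inj₁ refl , (1ℚ , 0ℚ , refl) , sym (x*1²≡x (ofℚ 1ℚ)) , *-identityˡ 1ₖ
  where open CommutativeRing (K-commutativeRing {d}) using (*-identityˡ)
... | refl | inj₂ refl = - 1ℚ , 1ₖ , inj₂ refl , (1ℚ , 0ℚ , refl) , sym (x*1²≡x (ofℚ (- 1ℚ))) , *-identityˡ 1ₖ
  where open CommutativeRing (K-commutativeRing {d}) using (*-identityˡ)
unit-signed-square m n (inj₂ (refl , ∣n∣≡1 , ∣m∣≡1)) with ∣i∣≡1+n⇒ m 0 ∣m∣≡1 | ∣i∣≡1+n⇒ n 0 ∣n∣≡1
... | inj₁ refl | inj₁ refl = - 1ℚ , ω , inj₂ refl , (_ , _ , refl) , refl , refl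
... | inj₁ refl | inj₂ refl = - 1ℚ , ω² , inj₂ refl , (_ , _ , refl) , refl , refl
... | inj₂ refl | inj₁ refl = 1ℚ , ω² , inj₁ refl , (_ , _ , refl) , refl , refl
... | inj₂ refl | inj₂ refl = 1ℚ , ω , inj₁ refl , (_ , _ , refl) , refl , refl

dℚ≡fromℤ : ∀ {d} → dℚ {d} ≡ fromℤ (+ d)
dℚ≡fromℤ {d} = n/1≡fromℤ (+ d)

0≤dℚ : ∀ {d} → 0ℚ ℚ.≤ dℚ {d}
0≤dℚ {d} = subst (0ℚ ℚ.≤_) (sym dℚ≡fromℤ) (ℚP.nonNegative⁻¹ (fromℤ (+ d)))

-- d (2Q)² = 4 - (2P)², so 2Q ∈ ℤ because d is squarefree.
norm-one-half-integral : ∀ {d} → SquareFree d → ∀ P Q m → P + P ≡ fromℤ m → P * P + dℚ {d} * (Q * Q) ≡ 1ℚ →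
                         Σ ℤ λ n → Q + Q ≡ fromℤ n × ∣ m ∣ ℕ.* ∣ m ∣ ℕ.+ d ℕ.* (∣ n ∣ ℕ.* ∣ n ∣) ≡ 4
norm-one-half-integral {d} sf P Q m 2P≡m N≡1 = n , 2Q≡n , ℤP.+-injective (begin
  + (∣ m ∣ ℕ.* ∣ m ∣ ℕ.+ d ℕ.* (∣ n ∣ ℕ.* ∣ n ∣))          ≡⟨ ℤP.pos-+ (∣ m ∣ ℕ.* ∣ m ∣) _ ⟩
  + (∣ m ∣ ℕ.* ∣ m ∣) ℤ.+ + (d ℕ.* (∣ n ∣ ℕ.* ∣ n ∣))
    ≡⟨ cong₂ ℤ._+_ (∣z∣²≡z² m) (trans (ℤP.pos-* d _) (cong (ℤ._*_ (+ d)) (∣z∣²≡z² n))) ⟩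
  m ℤ.* m ℤ.+ + d ℤ.* (n ℤ.* n)                            ≡⟨ fromℤ-injective m²+dn²≡4 ⟩
  + 4                                                       ∎)
  where
  open ≡-Reasoning
  T = Q + Q

  m²+dT²≡4 : fromℤ m * fromℤ m + fromℤ (+ d) * (T * T) ≡ fromℤ (+ 4)
  m²+dT²≡4 = begin
    fromℤ m * fromℤ m + fromℤ (+ d) * (T * T)        ≡⟨ cong₂ (λ s D → s * s + D * (T * T)) 2P≡m dℚ≡fromℤ ⟨
    (P + P) * (P + P) + dℚ {d} * (T * T)              ≡⟨ trace²+d[2Q]² (dℚ {d}) P Q ⟩
    fromℤ (+ 4) * (P * P + dℚ {d} * (Q * Q))          ≡⟨ cong (fromℤ (+ 4) *_) N≡1 ⟩
    fromℤ (+ 4) * 1ℚ                                  ≡⟨ ℚP.*-identityʳ _ ⟩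
    fromℤ (+ 4)                                       ∎
    where
    trace²+d[2Q]² : ∀ D P Q → (P + P) * (P + P) + D * ((Q + Q) * (Q + Q)) ≡ fromℤ (+ 4) * (P * P + D * (Q * Q))
    trace²+d[2Q]² = solve-∀ ℚ-ring

  dT²≡4-m² : fromℤ (+ d) * (T * T) ≡ fromℤ (+ 4 ℤ.- m ℤ.* m)
  dT²≡4-m² = begin
    fromℤ (+ d) * (T * T)                                           ≡⟨ cancel (fromℤ m * fromℤ m) _ ⟨
    (fromℤ m * fromℤ m + fromℤ (+ d) * (T * T)) - fromℤ m * fromℤ m ≡⟨ cong (_- fromℤ m * fromℤ m) m²+dT²≡4 ⟩
    fromℤ (+ 4) - fromℤ m * fromℤ m                                 ≡⟨ cong (λ t → fromℤ (+ 4) - t) (fromℤ-* m m) ⟨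
    fromℤ (+ 4) - fromℤ (m ℤ.* m)                                   ≡⟨ cong (_+_ (fromℤ (+ 4))) (fromℤ-neg (m ℤ.* m)) ⟨
    fromℤ (+ 4) + fromℤ (ℤ.- (m ℤ.* m))                             ≡⟨ fromℤ-+ (+ 4) (ℤ.- (m ℤ.* m)) ⟨
    fromℤ (+ 4 ℤ.- m ℤ.* m)                                         ∎
    where
    cancel : ∀ a b → (a + b) - a ≡ b
    cancel = solve-∀ ℚ-ring

  n : ℤ
  n = proj₁ (squarefree-rational-root sf T (+ 4 ℤ.- m ℤ.* m) dT²≡4-m²)
  2Q≡n : T ≡ fromℤ n
  2Q≡n = proj₂ (squarefree-rational-root sf T (+ 4 ℤ.- m ℤ.* m) dT²≡4-m²)

  m²+dn²≡4 : fromℤ (m ℤ.* m ℤ.+ + d ℤ.* (n ℤ.* n)) ≡ fromℤ (+ 4)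
  m²+dn²≡4 = begin
    fromℤ (m ℤ.* m ℤ.+ + d ℤ.* (n ℤ.* n))                 ≡⟨ fromℤ-+ (m ℤ.* m) _ ⟩
    fromℤ (m ℤ.* m) + fromℤ (+ d ℤ.* (n ℤ.* n))
      ≡⟨ cong₂ _+_ (fromℤ-* m m) (trans (fromℤ-* (+ d) _) (cong (fromℤ (+ d) *_) (fromℤ-* n n))) ⟩
    fromℤ m * fromℤ m + fromℤ (+ d) * (fromℤ n * fromℤ n) ≡⟨ cong (λ t → fromℤ m * fromℤ m + fromℤ (+ d) * (t * t)) 2Q≡n ⟨
    fromℤ m * fromℤ m + fromℤ (+ d) * (T * T)             ≡⟨ m²+dT²≡4 ⟩
    fromℤ (+ 4)                                           ∎

module Units {d : ℕ} (closed : IntegralsClosed d) where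
  open IntegralsClosed closed
  open import Algebra.Properties.CommutativeSemigroup (CommutativeRing.*-commutativeSemigroup (K-commutativeRing {d})) using (interchange)
  open IsℚEndomorphism (σ-isℚEndomorphism {d}) using () renaming (*-homo to σ-*)

  σ-integral : ∀ {x : K d} → IsIntegral x → IsIntegral (σ x)
  σ-integral = integral-preserved σ-isℚEndomorphism

  norm-natural : ∀ {P Q} → IsIntegral (P +√-d Q) → Σ ℕ λ k → P * P + dℚ {d} * (Q * Q) ≡ fromℤ (+ k)
  norm-natural {P} {Q} x-int =
    let z , N≡z = integral-ofℚ⇒ℤ (subst IsIntegral (norm-+√-d P Q) (*-closed x-int (σ-integral x-int)))
        k , z≡k = 0≤fromℤ⇒ℕ z (subst (0ℚ ℚ.≤_) N≡z (0≤+-nonNeg (0≤p*p P) (0≤*-nonNeg (0≤dℚ {d}) (0≤p*p Q))))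
    in k , trans N≡z (cong fromℤ z≡k)

  trace-integral : ∀ {P Q} → IsIntegral (P +√-d Q) → Σ ℤ λ m → P + P ≡ fromℤ m
  trace-integral {P} {Q} x-int = integral-ofℚ⇒ℤ (subst IsIntegral (trace-+√-d P Q) (+-closed x-int (σ-integral x-int)))

  unit-norm≡1 : ∀ {P Q P′ Q′} → IsIntegral (P +√-d Q) → IsIntegral (P′ +√-d Q′) →
                (P +√-d Q) *ₖ (P′ +√-d Q′) ≡ 1ₖ → P * P + dℚ {d} * (Q * Q) ≡ 1ℚ
  unit-norm≡1 {P} {Q} {P′} {Q′} v-int w-int vw≡1 =
    trans Nv≡k (cong (λ t → fromℤ (+ t)) (ℕP.m*n≡1⇒m≡1 k l kl≡1))
    where
    open ≡-Reasoning
    v w : K d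
    v = P +√-d Q
    w = P′ +√-d Q′
    Nv Nw : ℚ
    Nv = P * P + dℚ {d} * (Q * Q)
    Nw = P′ * P′ + dℚ {d} * (Q′ * Q′)
    k = proj₁ (norm-natural v-int)
    Nv≡k = proj₂ (norm-natural v-int)
    l = proj₁ (norm-natural w-int)
    Nw≡l = proj₂ (norm-natural w-int)
    NvNw≡1 : Nv * Nw ≡ 1ℚ
    NvNw≡1 = ofℚ-injective (begin
      ofℚ (Nv * Nw)                 ≡⟨ ofℚ-* Nv Nw ⟩
      ofℚ Nv *ₖ ofℚ Nw              ≡⟨ cong₂ _*ₖ_ (norm-+√-d P Q) (norm-+√-d P′ Q′) ⟨
      (v *ₖ σ v) *ₖ (w *ₖ σ w)      ≡⟨ interchange v (σ v) w (σ w) ⟩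
      (v *ₖ w) *ₖ (σ v *ₖ σ w)      ≡⟨ cong ((v *ₖ w) *ₖ_) (σ-* v w) ⟨
      (v *ₖ w) *ₖ σ (v *ₖ w)        ≡⟨ cong (λ t → t *ₖ σ t) vw≡1 ⟩
      1ₖ *ₖ σ 1ₖ                    ≡⟨ CommutativeRing.*-identityˡ K-commutativeRing 1ₖ ⟩
      ofℚ 1ℚ                        ∎)
    kl≡1 : k ℕ.* l ≡ 1
    kl≡1 = ℤP.+-injective (fromℤ-injective (begin
      fromℤ (+ (k ℕ.* l))           ≡⟨ cong fromℤ (ℤP.pos-* k l) ⟩
      fromℤ (+ k ℤ.* + l)           ≡⟨ fromℤ-* (+ k) (+ l) ⟩
      fromℤ (+ k) * fromℤ (+ l)     ≡⟨ cong₂ _*_ Nv≡k Nw≡l ⟨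
      Nv * Nw                       ≡⟨ NvNw≡1 ⟩
      1ℚ                            ∎))

  unit⇒signed-square : 2 ≤ d → SquareFree d → ∀ {P Q P′ Q′} → IsIntegral (P +√-d Q) → IsIntegral (P′ +√-d Q′) →
                       (P +√-d Q) *ₖ (P′ +√-d Q′) ≡ 1ₖ → SignedSquare (P +√-d Q)
  unit⇒signed-square 2≤d sf {P} {Q} v-int w-int vw≡1 =
    let m , 2P≡m = trace-integral v-int
        n , 2Q≡n , m²+dn²≡4 = norm-one-half-integral sf P Q m 2P≡m (unit-norm≡1 v-int w-int vw≡1)
    in subst SignedSquare (cong₂ _+√-d_ (half 2P≡m) (half 2Q≡n))
         (unit-signed-square m n (sum-of-squares≡4 2≤d sf ∣ m ∣ ∣ n ∣ m²+dn²≡4))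
    where
    half : ∀ {p z} → p + p ≡ fromℤ z → fromℤ z * ½ ≡ p
    half {p} 2p≡z = sym (trans (halve p) (cong (_* ½) 2p≡z))
      where
      halve : ∀ p → p ≡ (p + p) * ½
      halve = solve-∀ ℚ-ring

-- A square root of ±c in ℚ(√-d) is rational or a rational multiple of √-d, so c or -c is a square in ℚ(√d).
±c-square⇒c-square : ∀ {d c ε X Y} → 0ℚ ℚ.≤ c → c ≢ 0ℚ → ε ≡ 1ℚ ⊎ ε ≡ - 1ℚ →
                     X * X - dℚ {d} * (Y * Y) ≡ c * ε → X * Y ≡ 0ℚ → Σ (QD d) λ y → y *ᵈ y ≡ ofℚᵈ c
±c-square⇒c-square {d} {c} {ε} {X} {Y} 0≤c c≢0 ε≡±1 real XY≡0 with *≡0⇒≡0⊎≡0 X Y XY≡0 | ε≡±1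
... | inj₁ refl | inj₁ refl = contradiction (nonNeg+nonNeg≡0⇒≡0 0≤c (0≤*-nonNeg (0≤dℚ {d}) (0≤p*p Y))
        (trans (rearrange (dℚ {d}) Y c) (trans (cong (λ t → c * 1ℚ - t) real) (ℚP.+-inverseʳ (c * 1ℚ))))) c≢0
  where
  rearrange : ∀ D Y c → c + D * (Y * Y) ≡ c * 1ℚ - (0ℚ * 0ℚ - D * (Y * Y))
  rearrange = solve-∀ ℚ-ring
... | inj₁ refl | inj₂ refl = 0ℚ +√ Y , cong₂ _+√_ (trans (re-part (dℚ {d}) Y) (trans (cong -_ real) (neg-neg c))) (sq-part Y)
  where
  re-part : ∀ D Y → 0ℚ * 0ℚ + D * (Y * Y) ≡ - (0ℚ * 0ℚ - D * (Y * Y))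
  re-part = solve-∀ ℚ-ring
  neg-neg : ∀ c → - (c * - 1ℚ) ≡ c
  neg-neg = solve-∀ ℚ-ring
  sq-part : ∀ Y → 0ℚ * Y + Y * 0ℚ ≡ 0ℚ
  sq-part = solve-∀ ℚ-ring
... | inj₂ refl | inj₁ refl = X +√ 0ℚ , cong₂ _+√_ (trans (re-part (dℚ {d}) X) (trans real (ℚP.*-identityʳ c))) (sq-part X)
  where
  re-part : ∀ D X → X * X + D * (0ℚ * 0ℚ) ≡ X * X - D * (0ℚ * 0ℚ)
  re-part = solve-∀ ℚ-ring
  sq-part : ∀ X → X * 0ℚ + 0ℚ * X ≡ 0ℚ
  sq-part = solve-∀ ℚ-ring
... | inj₂ refl | inj₂ refl = contradiction (nonNeg+nonNeg≡0⇒≡0 0≤c (0≤p*p X)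
        (trans (rearrange (dℚ {d}) X c) (trans (cong (_- c * - 1ℚ) real) (ℚP.+-inverseʳ (c * - 1ℚ))))) c≢0
  where
  rearrange : ∀ D X c → c + X * X ≡ (X * X - D * (0ℚ * 0ℚ)) - c * - 1ℚ
  rearrange = solve-∀ ℚ-ring

square-in-ℚ√-d⇒square-in-ℚ√d : ∀ {d c ε} X Y → 0ℚ ℚ.≤ c → c ≢ 0ℚ → ε ≡ 1ℚ ⊎ ε ≡ - 1ℚ →
                                (X +√-d Y) *ₖ (X +√-d Y) ≡ ofℚ {d} (c * ε) → Σ (QD d) λ y → y *ᵈ y ≡ ofℚᵈ c
square-in-ℚ√-d⇒square-in-ℚ√d {d} {c} {ε} X Y 0≤c c≢0 ε≡±1 u²≡cε =
  ±c-square⇒c-square {d} {c} {ε} {X} {Y} 0≤c c≢0 ε≡±1 (cong (re ∘ realPart) components)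
    (trans (halve X Y) (cong (_* ½) (cong (sq ∘ imagPart) components)))
  where
  components : (X * X - dℚ {d} * (Y * Y)) +√-d (X * Y + Y * X) ≡ (c * ε) +√-d 0ℚ
  components = trans (sym (+√-d-* X Y X Y)) u²≡cε
  halve : ∀ X Y → X * Y ≡ (X * Y + Y * X) * ½
  halve = solve-∀ ℚ-ring

module _ {d : ℕ} where
  private module k = CommutativeRing (K-commutativeRing {d})
  open import Algebra.Properties.CommutativeSemigroup k.*-commutativeSemigroup using (interchange; x∙yz≈y∙xz)

  *-τ-self : ∀ a b → (ofℚᵈ a +i ofℚᵈ b) *ₖ τ (ofℚᵈ a +i ofℚᵈ b) ≡ ofℚ {d} (a * a + b * b)
  *-τ-self a b = cong₂ _+i_
    (trans (solve 2 (λ u v → u :* u :- v :* (:- v) := u :* u :+ v :* v) refl (ofℚᵈ a) (ofℚᵈ b))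
           (sym (cong₂ _+ᵈ_ (ofℚᵈ-* a a) (ofℚᵈ-* b b))))
    (solve 2 (λ u v → u :* (:- v) :+ v :* u := con 0ℚ) refl (ofℚᵈ a) (ofℚᵈ b))
    where open QD-Solver

  twisted-square : ∀ c ε (z v w : K d) → z *ₖ z ≡ ofℚ c *ₖ v → v ≡ ofℚ ε *ₖ (w *ₖ w) → w *ₖ σ w ≡ 1ₖ →
                   (z *ₖ σ w) *ₖ (z *ₖ σ w) ≡ ofℚ (c * ε)
  twisted-square c ε z v w z²≡cv v≡εw² wσw≡1 = begin
    (z *ₖ σ w) *ₖ (z *ₖ σ w)                         ≡⟨ interchange z (σ w) z (σ w) ⟩
    (z *ₖ z) *ₖ (σ w *ₖ σ w)                         ≡⟨ cong (_*ₖ (σ w *ₖ σ w)) (trans z²≡cv (cong (ofℚ c *ₖ_) v≡εw²)) ⟩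
    (ofℚ c *ₖ (ofℚ ε *ₖ (w *ₖ w))) *ₖ (σ w *ₖ σ w)   ≡⟨ cong (_*ₖ (σ w *ₖ σ w)) (k.*-assoc (ofℚ c) (ofℚ ε) (w *ₖ w)) ⟨
    ((ofℚ c *ₖ ofℚ ε) *ₖ (w *ₖ w)) *ₖ (σ w *ₖ σ w)   ≡⟨ k.*-assoc (ofℚ c *ₖ ofℚ ε) (w *ₖ w) (σ w *ₖ σ w) ⟩
    (ofℚ c *ₖ ofℚ ε) *ₖ ((w *ₖ w) *ₖ (σ w *ₖ σ w))   ≡⟨ cong ((ofℚ c *ₖ ofℚ ε) *ₖ_) (interchange w w (σ w) (σ w)) ⟩
    (ofℚ c *ₖ ofℚ ε) *ₖ ((w *ₖ σ w) *ₖ (w *ₖ σ w))   ≡⟨ cong₂ _*ₖ_ (sym (ofℚ-* c ε)) (cong (λ t → t *ₖ t) wσw≡1) ⟩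
    ofℚ (c * ε) *ₖ (1ₖ *ₖ 1ₖ)                        ≡⟨ x*1²≡x (ofℚ (c * ε)) ⟩
    ofℚ (c * ε)                                      ∎
    where open ≡-Reasoning

  IntegralPairs : List (K d × K d) → Set
  IntegralPairs = All (λ st → IsIntegral (proj₁ st) × IsIntegral (proj₂ st))

  sum-of-products : List (K d × K d) → K d
  sum-of-products ps = sumₖ (map (λ st → proj₁ st *ₖ proj₂ st) ps)

  sum-of-products-integral : IntegralsClosed d → ∀ {ps} → IntegralPairs ps → IsIntegral (sum-of-products ps)
  sum-of-products-integral closed []                      = 0-integral
  sum-of-products-integral closed ((s-int , t-int) ∷ all) =
    IntegralsClosed.+-closed closed (IntegralsClosed.*-closed closed s-int t-int) (sum-of-products-integral closed all)

  ⟨γ⟩²-element : ∀ {γ} {H : SubsetK {d}} → (∀ {z} → H z → ⟨ γ ⟩ z) → ∀ {z} → (H ·ᴵ H) z →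
                 Σ (List (K d × K d)) λ ps → IntegralPairs ps × z ≡ (γ *ₖ γ) *ₖ sum-of-products ps
  ⟨γ⟩²-element {γ} H⊆γ ([] , [] , z≡0) = [] , [] , trans z≡0 (sym (k.zeroʳ (γ *ₖ γ)))
  ⟨γ⟩²-element {γ} {H} H⊆γ (((x , y) ∷ xys) , ((x∈H , y∈H) ∷ all) , z≡xy+rest) =
    let s , s-int , x≡γs = H⊆γ x∈H
        t , t-int , y≡γt = H⊆γ y∈H
        ps , ps-int , rest≡γ²S = ⟨γ⟩²-element {γ} {H} H⊆γ (xys , all , refl)
        S = sum-of-products ps
    in (s , t) ∷ ps , (s-int , t-int) ∷ ps-int , (begin
      _                                               ≡⟨ z≡xy+rest ⟩
      x *ₖ y +ₖ sum-of-products xys                   ≡⟨ cong₂ _+ₖ_ (cong₂ _*ₖ_ x≡γs y≡γt) rest≡γ²S ⟩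
      (γ *ₖ s) *ₖ (γ *ₖ t) +ₖ (γ *ₖ γ) *ₖ S           ≡⟨ cong (_+ₖ (γ *ₖ γ) *ₖ S) (interchange γ s γ t) ⟩
      (γ *ₖ γ) *ₖ (s *ₖ t) +ₖ (γ *ₖ γ) *ₖ S           ≡⟨ k.distribˡ (γ *ₖ γ) (s *ₖ t) S ⟨
      (γ *ₖ γ) *ₖ (s *ₖ t +ₖ S)                       ∎)
    where open ≡-Reasoning

  cancelˡ : ∀ {γ γ⁻¹ x y : K d} → γ⁻¹ *ₖ γ ≡ 1ₖ → γ *ₖ x ≡ γ *ₖ y → x ≡ y
  cancelˡ {γ} {γ⁻¹} {x} {y} inverse γx≡γy = begin
    x                   ≡⟨ k.*-identityˡ x ⟨
    1ₖ *ₖ x             ≡⟨ cong (_*ₖ x) inverse ⟨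
    (γ⁻¹ *ₖ γ) *ₖ x     ≡⟨ k.*-assoc γ⁻¹ γ x ⟩
    γ⁻¹ *ₖ (γ *ₖ x)     ≡⟨ cong (γ⁻¹ *ₖ_) γx≡γy ⟩
    γ⁻¹ *ₖ (γ *ₖ y)     ≡⟨ k.*-assoc γ⁻¹ γ y ⟨
    (γ⁻¹ *ₖ γ) *ₖ y     ≡⟨ cong (_*ₖ y) inverse ⟩
    1ₖ *ₖ y             ≡⟨ k.*-identityˡ y ⟩
    y                   ∎
    where open ≡-Reasoning

  -- Closure of the algebraic integers under + and · is not available in general; for a fractional
  -- ideal generated by an invertible γ it follows from r (γ s) ∈ H = γ O_k by cancelling γ.
  invertible-generator⇒IntegralsClosed : ∀ {H γ γ⁻¹} → IsFractionalIdeal H →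
    (∀ {z} → H z → ⟨ γ ⟩ z) → (∀ {z} → ⟨ γ ⟩ z → H z) → γ⁻¹ *ₖ γ ≡ 1ₖ → IntegralsClosed d
  invertible-generator⇒IntegralsClosed {H} {γ} {γ⁻¹} isH H⊆γ γ⊆H inverse = record
    { *-closed = λ {r} {s} r-int s-int → integral-from-γ
        (subst ⟨ γ ⟩ (sym (x∙yz≈y∙xz γ r s)) (H⊆γ (*-closed r-int (γ*-∈H s-int))))
    ; +-closed = λ {r} {s} r-int s-int → integral-from-γ
        (subst ⟨ γ ⟩ (sym (k.distribˡ γ r s)) (H⊆γ (+-closed (γ*-∈H r-int) (γ*-∈H s-int)))) }
    where
    open IsFractionalIdeal isH
    γ*-∈H : ∀ {r} → IsIntegral r → H (γ *ₖ r)
    γ*-∈H {r} r-int = γ⊆H (r , r-int , refl)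
    integral-from-γ : ∀ {x} → ⟨ γ ⟩ (γ *ₖ x) → IsIntegral x
    integral-from-γ {x} (u , u-int , γx≡γu) = subst IsIntegral (sym (cancelˡ {γ} {γ⁻¹} {x} {u} inverse γx≡γu)) u-int

-- H is not principal

module _ {d : ℕ} (2≤d : 2 ≤ d) (sf : SquareFree d) (a b : ℚ)
         (no-√c : ¬ (Σ (QD d) λ y → y *ᵈ y ≡ ofℚᵈ (a * a + b * b)))
         (H : SubsetK {d}) (isH : IsFractionalIdeal H) (H²≐α : (H ·ᴵ H) ≐ ⟨ ofℚᵈ a +i ofℚᵈ b ⟩) where
  private
    module k = CommutativeRing (K-commutativeRing {d})
    open import Algebra.Properties.CommutativeSemigroup k.*-commutativeSemigroup using (interchange)
    open IsℚEndomorphism (τ-isℚEndomorphism {d}) using () renaming (*-homo to τ-*)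
    open IsℚEndomorphism (σ-isℚEndomorphism {d}) using () renaming (*-homo to σ-*)

    α : K d
    α = ofℚᵈ a +i ofℚᵈ b
    c : ℚ
    c = a * a + b * b

  c≢0 : c ≢ 0ℚ
  c≢0 c≡0 = no-√c (ofℚᵈ 0ℚ , cong (_+√ 0ℚ) (trans (zero² (dℚ {d})) (sym c≡0)))
    where
    zero² : ∀ D → 0ℚ * 0ℚ + D * (0ℚ * 0ℚ) ≡ 0ℚ
    zero² = solve-∀ ℚ-ring

  α≢0 : α ≢ 0ₖ
  α≢0 α≡0 = c≢0 (cong₂ (λ x y → x * x + y * y) (cong (re ∘ realPart) α≡0) (cong (re ∘ imagPart) α≡0))

  module _ (γ : K d) (H⊆γ : ∀ {z} → H z → ⟨ γ ⟩ z) (γ⊆H : ∀ {z} → ⟨ γ ⟩ z → H z) where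
    open ≡-Reasoning

    γ²≡αr : Σ (K d) λ r → IsIntegral r × γ *ₖ γ ≡ α *ₖ r
    γ²≡αr = proj₁ H²≐α ((γ , γ) ∷ [] , (γ∈H , γ∈H) ∷ [] , sym (k.+-identityʳ (γ *ₖ γ)))
      where
      γ∈H : H γ
      γ∈H = γ⊆H (1ₖ , 1-integral , sym (k.*-identityʳ γ))

    α≡γ²S : Σ (List (K d × K d)) λ ps → IntegralPairs ps × α ≡ (γ *ₖ γ) *ₖ sum-of-products ps
    α≡γ²S = ⟨γ⟩²-element {γ = γ} {H = H} H⊆γ (proj₂ H²≐α (1ₖ , 1-integral , sym (k.*-identityʳ α)))

    private
      r : K d
      r = proj₁ γ²≡αr
      S : K d
      S = sum-of-products (proj₁ α≡γ²S)
      c⁻¹ : ℚ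
      c⁻¹ = (ℚ.1/ c) {{ℚ.≢-nonZero c≢0}}

    -- γ⁻¹ = γ S τ(α) / c, since γ² S = α and α τ(α) = c.
    γ⁻¹ : K d
    γ⁻¹ = ((γ *ₖ S) *ₖ τ α) *ₖ ofℚ c⁻¹

    γ⁻¹γ≡1 : γ⁻¹ *ₖ γ ≡ 1ₖ
    γ⁻¹γ≡1 = begin
      ((γ *ₖ S) *ₖ τ α) *ₖ ofℚ c⁻¹ *ₖ γ
        ≡⟨ solve 4 (λ g s t i → (((g ⊕ s) ⊕ t) ⊕ i) ⊕ g ⊜ (((g ⊕ g) ⊕ s) ⊕ t) ⊕ i) refl γ S (τ α) (ofℚ c⁻¹) ⟩
      (γ *ₖ γ) *ₖ S *ₖ τ α *ₖ ofℚ c⁻¹     ≡⟨ cong (λ x → x *ₖ τ α *ₖ ofℚ c⁻¹) (proj₂ (proj₂ α≡γ²S)) ⟨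
      α *ₖ τ α *ₖ ofℚ c⁻¹                 ≡⟨ cong (_*ₖ ofℚ c⁻¹) (*-τ-self a b) ⟩
      ofℚ c *ₖ ofℚ c⁻¹                    ≡⟨ ofℚ-* c c⁻¹ ⟨
      ofℚ (c * c⁻¹)                       ≡⟨ cong ofℚ (ℚP.*-inverseʳ c {{ℚ.≢-nonZero c≢0}}) ⟩
      1ₖ                                  ∎
      where open import Algebra.Solver.CommutativeMonoid k.*-commutativeMonoid using (solve; _⊕_; _⊜_)

    closed : IntegralsClosed d
    closed = invertible-generator⇒IntegralsClosed {γ = γ} {γ⁻¹ = γ⁻¹} isH H⊆γ γ⊆H γ⁻¹γ≡1

    Sr≡1 : S *ₖ r ≡ 1ₖ
    Sr≡1 = cancelˡ {γ = γ *ₖ γ} {γ⁻¹ = γ⁻¹ *ₖ γ⁻¹} γ⁻²γ²≡1 (begin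
      (γ *ₖ γ) *ₖ (S *ₖ r)    ≡⟨ k.*-assoc (γ *ₖ γ) S r ⟨
      (γ *ₖ γ) *ₖ S *ₖ r      ≡⟨ cong (_*ₖ r) (proj₂ (proj₂ α≡γ²S)) ⟨
      α *ₖ r                  ≡⟨ proj₂ (proj₂ γ²≡αr) ⟨
      γ *ₖ γ                  ≡⟨ k.*-identityʳ (γ *ₖ γ) ⟨
      (γ *ₖ γ) *ₖ 1ₖ          ∎)
      where
      γ⁻²γ²≡1 : (γ⁻¹ *ₖ γ⁻¹) *ₖ (γ *ₖ γ) ≡ 1ₖ
      γ⁻²γ²≡1 = trans (interchange γ⁻¹ γ⁻¹ γ γ) (trans (cong₂ _*ₖ_ γ⁻¹γ≡1 γ⁻¹γ≡1) (k.*-identityˡ 1ₖ))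

    private
      τ-integral : ∀ {x} → IsIntegral x → IsIntegral (τ x)
      τ-integral = integral-preserved (τ-isℚEndomorphism {d})
      v w z : K d
      v = r *ₖ τ r
      w = S *ₖ τ S
      z = γ *ₖ τ γ

    vw≡1 : v *ₖ w ≡ 1ₖ
    vw≡1 = begin
      (r *ₖ τ r) *ₖ (S *ₖ τ S)    ≡⟨ interchange r (τ r) S (τ S) ⟩
      (r *ₖ S) *ₖ (τ r *ₖ τ S)    ≡⟨ cong ((r *ₖ S) *ₖ_) (τ-* r S) ⟨
      (r *ₖ S) *ₖ τ (r *ₖ S)      ≡⟨ cong (λ t → t *ₖ τ t) (trans (k.*-comm r S) Sr≡1) ⟩
      1ₖ *ₖ τ 1ₖ                  ≡⟨ k.*-identityˡ 1ₖ ⟩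
      1ₖ                          ∎

    v-signed-square : SignedSquare v
    v-signed-square =
      let P , Q , v≡ = τ-fixed⇒Inℚ√-d (*-τ-self-τ-fixed r)
          P′ , Q′ , w≡ = τ-fixed⇒Inℚ√-d (*-τ-self-τ-fixed S)
          r-int = proj₁ (proj₂ γ²≡αr)
          S-int = sum-of-products-integral closed (proj₁ (proj₂ α≡γ²S))
      in subst SignedSquare (sym v≡)
           (Units.unit⇒signed-square closed 2≤d sf
             (subst IsIntegral v≡ (IntegralsClosed.*-closed closed r-int (τ-integral {r} r-int)))
             (subst IsIntegral w≡ (IntegralsClosed.*-closed closed S-int (τ-integral {S} S-int)))
             (subst₂ (λ x y → x *ₖ y ≡ 1ₖ) v≡ w≡ vw≡1))

    z²≡cv : z *ₖ z ≡ ofℚ c *ₖ v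
    z²≡cv = begin
      (γ *ₖ τ γ) *ₖ (γ *ₖ τ γ)    ≡⟨ interchange γ (τ γ) γ (τ γ) ⟩
      (γ *ₖ γ) *ₖ (τ γ *ₖ τ γ)    ≡⟨ cong ((γ *ₖ γ) *ₖ_) (τ-* γ γ) ⟨
      (γ *ₖ γ) *ₖ τ (γ *ₖ γ)      ≡⟨ cong (λ t → t *ₖ τ t) (proj₂ (proj₂ γ²≡αr)) ⟩
      (α *ₖ r) *ₖ τ (α *ₖ r)      ≡⟨ cong ((α *ₖ r) *ₖ_) (τ-* α r) ⟩
      (α *ₖ r) *ₖ (τ α *ₖ τ r)    ≡⟨ interchange α r (τ α) (τ r) ⟩
      (α *ₖ τ α) *ₖ v             ≡⟨ cong (_*ₖ v) (*-τ-self a b) ⟩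
      ofℚ c *ₖ v                  ∎

    √c : Σ (QD d) λ y → y *ᵈ y ≡ ofℚᵈ c
    √c =
      let ε , w₀ , ε≡±1 , (X₀ , Y₀ , w₀≡) , v≡εw₀² , w₀σw₀≡1 = v-signed-square
          P , Q , z≡ = τ-fixed⇒Inℚ√-d (*-τ-self-τ-fixed γ)
          u≡ = trans (cong₂ _*ₖ_ z≡ (cong σ w₀≡)) (+√-d-* P Q X₀ (- Y₀))
      in square-in-ℚ√-d⇒square-in-ℚ√d (P * X₀ - dℚ {d} * (Q * - Y₀)) (P * - Y₀ + Q * X₀)
           (0≤+-nonNeg (0≤p*p a) (0≤p*p b)) c≢0 ε≡±1
           (subst (λ t → t *ₖ t ≡ ofℚ (c * ε)) u≡ (twisted-square c ε z v w₀ z²≡cv v≡εw₀² w₀σw₀≡1))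

  H-not-principal : ¬ IsPrincipal H
  H-not-principal (γ , _ , H⊆γ , γ⊆H) = no-√c (√c γ H⊆γ γ⊆H)

proposition1 : (d : ℕ) → 2 ≤ d → SquareFree d →
    (a b : ℚ) →
    ¬ (Σ (QD d) λ y → y *ᵈ y ≡ ofℚᵈ (a * a + b * b)) →
    (H : SubsetK {d}) → IsFractionalIdeal H →
    (H ·ᴵ H) ≐ ⟨ ofℚᵈ a +i ofℚᵈ b ⟩ →
    HasClassOrderTwo H
proposition1 d 2≤d sf a b no-√c H isH H²≐α =
  (ofℚᵈ a +i ofℚᵈ b , α≢0 2≤d sf a b no-√c H isH H²≐α , H²≐α) , H-not-principal 2≤d sf a b no-√c H isH H²≐α
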